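{- Let $m, n$ be positive integers and let $p$ be an odd prime. Then the equation $P_n = 4p^m$ holds only for $n=4$, $p=3$, $m=1$.
   Context: The Pell sequence $(P_n)_{n\ge 0}$ is defined by $P_0=0$, $P_1=1$, $P_{n+1}=2P_n+P_{n-1}$ for $n\ge1$. -}

module Defs where

open import Data.Nat using (ℕ; zero; suc; _+_; _*_)

pell : ℕ → ℕ
pell zero = 0
pell (suc zero) = 1
pell (suc (suc n)) = 2 * pell (suc n) + pell n

module Submission where

-- * Pell numbers of odd index are odd, so n is even, n = 2k, and n ≥ 1
--   forces k ≥ 1.
-- * The addition formula P (a + b + 1) = P (a+1) P (b+1) + P a P b gives
--   the duplication formula P (2k) = 2 · P k · (P k + P (k-1)), hence
--   P k · (P k + P (k-1)) = 2 p ^ m.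
-- * Consecutive Pell numbers are coprime, so the two factors P k and
--   P k + P (k-1) are coprime.  Of two coprime numbers whose product is
--   p ^ m · c, one is prime to p and therefore divides c; here c = 2.
-- * Since P k ≥ k, both factors exceed 2 once k ≥ 3, a contradiction.
--   The cases k = 1 (P 2 = 2) and k = 2 (P 4 = 12 = 4 · 3) are computed
--   directly, and p ^ m = 3 forces p = 3 and m = 1.
-- The hypotheses m ≥ 1 and "p odd" turn out not to be needed.

open import Defs
open import Data.Nat using (ℕ; zero; suc; _+_; _*_; _^_; _≤_; _<_; _≥_; z≤n; s≤s)
open import Data.Nat.Properties
open import Data.Nat.Divisibility
open import Data.Nat.Coprimality using (Coprime; coprime-divisor)
open import Data.Nat.Primality using (Prime; prime?; prime⇒irreducible; prime⇒nonZero; ¬prime[1])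
open import Data.Nat.Tactic.RingSolver using (solve-∀)
open import Data.Product using (_×_; _,_; ∃-syntax)
open import Data.Sum using (_⊎_; inj₁; inj₂)
open import Data.Unit using (tt)
open import Data.Empty using (⊥-elim)
open import Relation.Nullary using (¬_; yes; no)
open import Relation.Nullary.Decidable using (toWitness)
open import Relation.Binary.PropositionalEquality

pell-add : ∀ a b → pell (suc (a + b)) ≡ pell (suc a) * pell (suc b) + pell a * pell b
pell-add zero b = sym (trans (+-identityʳ _) (+-identityʳ _))
pell-add (suc a) b = begin
    pell (suc (suc a + b))
  ≡⟨ cong (λ t → pell (suc t)) (sym (+-suc a b)) ⟩
    pell (suc (a + suc b))
  ≡⟨ pell-add a (suc b) ⟩
    pell (suc a) * (2 * pell (suc b) + pell b) + pell a * pell (suc b)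
  ≡⟨ regroup (pell (suc a)) (pell a) (pell (suc b)) (pell b) ⟩
    (2 * pell (suc a) + pell a) * pell (suc b) + pell (suc a) * pell b ∎
  where
  open ≡-Reasoning
  regroup : ∀ x y u v → x * (2 * u + v) + y * u ≡ (2 * x + y) * u + x * v
  regroup = solve-∀

pell-double : ∀ j → pell (suc j + suc j) ≡ 2 * (pell (suc j) * (pell (suc j) + pell j))
pell-double j = begin
    pell (suc (j + suc j))
  ≡⟨ pell-add j (suc j) ⟩
    pell (suc j) * (2 * pell (suc j) + pell j) + pell j * pell (suc j)
  ≡⟨ factor (pell (suc j)) (pell j) ⟩
    2 * (pell (suc j) * (pell (suc j) + pell j)) ∎
  where
  open ≡-Reasoning
  factor : ∀ x y → x * (2 * x + y) + y * x ≡ 2 * (x * (x + y))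
  factor = solve-∀

-- Pell numbers of odd index are odd, since P (i+2) ≡ P i modulo 2.
pell-odd : ∀ k → ¬ (2 ∣ pell (suc (k + k)))
pell-odd zero 2∣1 with ∣1⇒≡1 2∣1
... | ()
pell-odd (suc k) 2∣P rewrite +-suc k k =
  pell-odd k (∣m+n∣m⇒∣n 2∣P (∣m⇒∣m*n (pell (suc (suc (k + k)))) ∣-refl))

-- Consecutive Pell numbers are coprime (Euclid's algorithm on the recurrence).
pell-coprime-succ : ∀ i → Coprime (pell (suc i)) (pell i)
pell-coprime-succ zero (d∣1 , _) = ∣1⇒≡1 d∣1
pell-coprime-succ (suc i) (d∣P₂ , d∣P₁) =
  pell-coprime-succ i (d∣P₁ , ∣m+n∣m⇒∣n d∣P₂ (∣n⇒∣m*n 2 d∣P₁))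

pell-coprime-factors : ∀ i → Coprime (pell (suc i)) (pell (suc i) + pell i)
pell-coprime-factors i (d∣P₁ , d∣sum) = pell-coprime-succ i (d∣P₁ , ∣m+n∣m⇒∣n d∣sum d∣P₁)

pell-≥-index : ∀ n → n ≤ pell n
pell-≥-index zero = z≤n
pell-≥-index (suc zero) = s≤s z≤n
pell-≥-index (suc (suc n)) = begin
    suc (suc n)                 ≤⟨ m≤m+n (suc (suc n)) (2 * n) ⟩
    suc (suc n) + 2 * n         ≡⟨ rearrange n ⟩
    2 * suc n + n               ≤⟨ +-mono-≤ (*-monoʳ-≤ 2 (pell-≥-index (suc n))) (pell-≥-index n) ⟩
    2 * pell (suc n) + pell n   ∎
  where
  open ≤-Reasoning
  rearrange : ∀ x → suc (suc x) + 2 * x ≡ 2 * suc x + x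
  rearrange = solve-∀

pell[3+i]>2 : ∀ i → 2 < pell (3 + i)
pell[3+i]>2 i = ≤-trans (m≤m+n 3 i) (pell-≥-index (3 + i))

prime-∤⇒coprime : ∀ {p x} → Prime p → ¬ (p ∣ x) → Coprime x p
prime-∤⇒coprime p-prime p∤x (d∣x , d∣p) with prime⇒irreducible p-prime d∣p
... | inj₁ d≡1 = d≡1
... | inj₂ refl = ⊥-elim (p∤x d∣x)

∣prime-power*⇒∣ : ∀ {p x c} m → Prime p → ¬ (p ∣ x) → x ∣ p ^ m * c → x ∣ c
∣prime-power*⇒∣ {c = c} zero _ _ x∣c rewrite *-identityˡ c = x∣c
∣prime-power*⇒∣ {p} {x} {c} (suc m) p-prime p∤x x∣pp^mc =
  ∣prime-power*⇒∣ m p-prime p∤x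
    (coprime-divisor (prime-∤⇒coprime p-prime p∤x) (subst (x ∣_) (*-assoc p (p ^ m) c) x∣pp^mc))

-- If a coprime pair multiplies to p ^ m · c, then one of its members divides c:
-- p cannot divide both, and the one it does not divide is absorbed by c.
coprime-product-of-prime-power : ∀ {p a b c} m → Prime p → Coprime a b →
  a * b ≡ p ^ m * c → a ∣ c ⊎ b ∣ c
coprime-product-of-prime-power {p} {a} {b} m p-prime a⊥b ab≡ with p ∣? a
... | no p∤a = inj₁ (∣prime-power*⇒∣ m p-prime p∤a (divides b (trans (sym ab≡) (*-comm a b))))
... | yes p∣a = inj₂ (∣prime-power*⇒∣ m p-prime p∤b (divides a (sym ab≡)))
  where
  p∤b : ¬ (p ∣ b)
  p∤b p∣b = ¬prime[1] (subst Prime (a⊥b (p∣a , p∣b)) p-prime)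

prime-power≡prime : ∀ {p q} m → Prime p → Prime q → p ^ m ≡ q → p ≡ q × m ≡ 1
prime-power≡prime zero _ q-prime refl = ⊥-elim (¬prime[1] q-prime)
prime-power≡prime {p} {q} (suc k) p-prime q-prime p^m≡q
  with prime⇒irreducible q-prime (divides (p ^ k) (trans (sym p^m≡q) (*-comm p (p ^ k))))
... | inj₁ refl = ⊥-elim (¬prime[1] p-prime)
... | inj₂ refl with m^n≡1⇒n≡0∨m≡1 p k p^k≡1
  where
  instance _ = prime⇒nonZero p-prime
  p^k≡1 : p ^ k ≡ 1
  p^k≡1 = *-cancelˡ-≡ (p ^ k) 1 p (trans p^m≡q (sym (*-identityʳ p)))
...   | inj₁ refl = refl , refl
...   | inj₂ refl = ⊥-elim (¬prime[1] p-prime)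

parity : ∀ n → (∃[ k ] n ≡ k + k) ⊎ (∃[ k ] n ≡ suc (k + k))
parity zero = inj₁ (0 , refl)
parity (suc n) with parity n
... | inj₁ (k , refl) = inj₂ (k , refl)
... | inj₂ (k , refl) = inj₁ (suc k , cong suc (sym (+-suc k k)))

-- For k ≥ 3, P (2k) ≠ 4 p ^ m: the coprime factors P k and P k + P (k-1)
-- of P (2k) / 2 = 2 p ^ m both exceed 2, yet one of them must divide 2.
pell-large-even≢4*prime-power : ∀ {p} m i → Prime p →
  ¬ (pell (3 + i + (3 + i)) ≡ 4 * p ^ m)
pell-large-even≢4*prime-power {p} m i p-prime P≡4p^m
  with coprime-product-of-prime-power m p-prime (pell-coprime-factors (2 + i)) ab≡p^m*2
  where
  ab≡p^m*2 : pell (3 + i) * (pell (3 + i) + pell (2 + i)) ≡ p ^ m * 2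
  ab≡p^m*2 = *-cancelˡ-≡ _ _ 2 (begin
      2 * (pell (3 + i) * (pell (3 + i) + pell (2 + i)))   ≡⟨ pell-double (2 + i) ⟨
      pell (3 + i + (3 + i))                               ≡⟨ P≡4p^m ⟩
      4 * p ^ m                                            ≡⟨ *-assoc 2 2 (p ^ m) ⟩
      2 * (2 * p ^ m)                                      ≡⟨ cong (2 *_) (*-comm 2 (p ^ m)) ⟩
      2 * (p ^ m * 2)                                      ∎)
    where open ≡-Reasoning
... | inj₁ a∣2 = >⇒∤ (pell[3+i]>2 i) a∣2
... | inj₂ b∣2 = >⇒∤ (≤-trans (pell[3+i]>2 i) (m≤m+n _ (pell (2 + i)))) b∣2

lemma2p6 : (m n p : ℕ) → m ≥ 1 → n ≥ 1 → Prime p → ¬ (2 ∣ p) →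
    pell n ≡ 4 * p ^ m → (n ≡ 4 × p ≡ 3 × m ≡ 1)
lemma2p6 m n p _ n≥1 p-prime _ P≡4p^m with parity n | subst (4 ∣_) (sym P≡4p^m) (m∣m*n (p ^ m))
... | inj₂ (k , refl) | 4∣P = ⊥-elim (pell-odd k (∣-trans (divides 2 refl) 4∣P))
... | inj₁ (0 , refl) | _ with () ← n≥1
... | inj₁ (1 , refl) | 4∣P = ⊥-elim (>⇒∤ (s≤s (s≤s (s≤s z≤n))) 4∣P)
... | inj₁ (2 , refl) | _ = refl , prime-power≡prime m p-prime (toWitness {a? = prime? 3} tt) p^m≡3
  where
  p^m≡3 : p ^ m ≡ 3
  p^m≡3 = *-cancelˡ-≡ (p ^ m) 3 4 (sym P≡4p^m)
... | inj₁ (suc (suc (suc i)) , refl) | _ = ⊥-elim (pell-large-even≢4*prime-power m i p-prime P≡4p^m)
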